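{- Let $q$ be a Sophie Germain prime and put $p = 2q+1$. If $z(p) \mid \pi(q)$, then $S(q) \neq \emptyset$.
   Context: A Sophie Germain prime is a prime $q$ such that $2q+1$ is also prime. $F_n$ denotes the $n$-th Fibonacci number ($F_0=0$, $F_1=1$, $F_n=F_{n-1}+F_{n-2}$) and $\varphi$ is Euler's totient function. For a prime $p$, $z(p)$ is the smallest positive integer $k$ with $p \mid F_k$. For a positive integer $n$, the Pisano period $\pi(n)$ is the period of $(F_m \bmod n)_{m\ge0}$. For an odd prime $q$, $S(q)$ is the set of residue classes $r \bmod \pi(q)$ such that $q \mid \varphi(F_m)$ for every positive integer $m \equiv r \pmod{\pi(q)}$. -}

module Defs where

open import Data.Nat using (ℕ; zero; suc; _+_; _*_; _<_; ∣_-_∣)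
open import Data.Nat.Divisibility using (_∣_)
open import Data.Nat.GCD using (gcd)
open import Data.Nat.Properties using (_≟_)
open import Data.Product using (_×_; ∃)
open import Relation.Nullary using (¬_; does)
open import Relation.Binary.PropositionalEquality renaming (_≡_ to _≡′_) using ()
open import Data.Bool using (if_then_else_)

F : ℕ → ℕ
F zero = zero
F (suc zero) = suc zero
F (suc (suc n)) = F (suc n) + F n

coprimeCount : ℕ → ℕ → ℕ
coprimeCount n zero = zero
coprimeCount n (suc k) =
  (if does (gcd (suc k) n ≟ 1) then 1 else 0) + coprimeCount n k

φ : ℕ → ℕ
φ n = coprimeCount n n

_≡_[mod_] : ℕ → ℕ → ℕ → Set
a ≡ b [mod n ] = n ∣ ∣ a - b ∣

IsZ : ℕ → ℕ → Set
IsZ p k = (0 < k) × (p ∣ F k) × (∀ j → 0 < j → j < k → ¬ (p ∣ F j))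

Periodic : ℕ → ℕ → Set
Periodic n P = ∀ m → F (m + P) ≡ F m [mod n ]

IsPisano : ℕ → ℕ → Set
IsPisano n P = (0 < P) × Periodic n P × (∀ Q → 0 < Q → Q < P → ¬ Periodic n Q)

-- r (with r < P) is a residue class mod P = π(q) belonging to S(q):
-- q ∣ φ(F m) for every positive m ≡ r (mod P)
InS : ℕ → ℕ → ℕ → Set
InS q P r = (r < P) × (∀ m → 0 < m → (∃ λ k → m ≡′ r + k * P) → q ∣ φ (F m))

{-# OPTIONS --safe #-}
-- Take r = 0.  If π(q) ∣ m then z(p) ∣ m, so p ∣ F m because the Fibonacci
-- numbers form a divisibility sequence.  For any prime p dividing n we have
-- p − 1 ∣ φ(n): writing n = t p, counting the k ≤ p t coprime to t once by
-- periodicity and once by splitting off the multiples of p gives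
-- φ(t p) = (p − 1) φ(t) if p ∤ t and φ(t p) = p φ(t) if p ∣ t, and in the
-- second case we recurse on t.  Here p − 1 = 2q, hence q ∣ φ(F m).
module Submission where

open import Defs
open import Data.Bool using (if_then_else_)
open import Data.Nat using (ℕ; zero; suc; pred; _+_; _*_; _<_; _≤_; z<s; NonZero; nonTrivial⇒≢1; nonTrivial⇒n>1)
open import Data.Nat.Properties
open import Data.Nat.Divisibility
open import Data.Nat.Coprimality using (Coprime; coprime?; coprime-+; coprime-divisor; coprime⇒gcd≡1; gcd≡1⇒coprime)
  renaming (sym to coprime-sym)
open import Data.Nat.GCD using (gcd)
open import Data.Nat.Induction using (<-rec)
open import Data.Nat.Primality using (Prime; prime⇒irreducible; prime⇒nonZero; prime⇒nonTrivial)
open import Data.Nat.Solver using (module +-*-Solver)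
open import Data.Product using (∃; _,_)
open import Data.Sum using (inj₁; inj₂)
open import Function using (_∘_)
open import Relation.Nullary using (¬_; Dec; does; yes; no; contradiction)
open import Relation.Nullary.Decidable using (dec-true; dec-false)
open import Relation.Binary.PropositionalEquality using (_≡_; _≢_; refl; sym; trans; cong; cong₂; subst; module ≡-Reasoning)

open +-*-Solver using (solve; _:+_; _:*_; _:=_)
open ≡-Reasoning

F-+ : ∀ m n → F (m + suc n) ≡ F (suc m) * F (suc n) + F m * F n
F-+ zero n = sym (trans (+-identityʳ _) (+-identityʳ (F (suc n))))
F-+ (suc m) n = begin
  F (suc m + suc n)                                ≡⟨ cong F (+-suc m (suc n)) ⟨
  F (m + suc (suc n))                              ≡⟨ F-+ m (suc n) ⟩
  F (suc m) * (F (suc n) + F n) + F m * F (suc n)  ≡⟨ rearrange (F (suc m)) (F m) (F (suc n)) (F n) ⟩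
  (F (suc m) + F m) * F (suc n) + F (suc m) * F n  ∎
  where
  rearrange : ∀ a b c d → a * (c + d) + b * c ≡ (a + b) * c + a * d
  rearrange = solve 4 (λ a b c d → a :* (c :+ d) :+ b :* c := (a :+ b) :* c :+ a :* d) refl

F∣F[k*n] : ∀ k n → F n ∣ F (k * n)
F∣F[k*n] k       zero    rewrite *-zeroʳ k = ∣-refl
F∣F[k*n] zero    (suc n) = F (suc n) ∣0
F∣F[k*n] (suc k) (suc n) = subst (F (suc n) ∣_) (sym F[sk*sn]≡)
  (∣m∣n⇒∣m+n (n∣m*n (F (suc (k * suc n)))) (∣m⇒∣m*n (F n) (F∣F[k*n] k (suc n))))
  where
  F[sk*sn]≡ : F (suc k * suc n) ≡ F (suc (k * suc n)) * F (suc n) + F (k * suc n) * F n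
  F[sk*sn]≡ = trans (cong F (+-comm (suc n) (k * suc n))) (F-+ (k * suc n) n)

∣⇒F∣F : ∀ {m n} → m ∣ n → F m ∣ F n
∣⇒F∣F (divides k refl) = F∣F[k*n] k _

sumTo : (ℕ → ℕ) → ℕ → ℕ
sumTo f zero    = 0
sumTo f (suc n) = f (suc n) + sumTo f n

sumTo-cong : ∀ {f g} → (∀ k → f k ≡ g k) → ∀ n → sumTo f n ≡ sumTo g n
sumTo-cong f≗g zero    = refl
sumTo-cong f≗g (suc n) = cong₂ _+_ (f≗g (suc n)) (sumTo-cong f≗g n)

sumTo-pred : ∀ f n .{{_ : NonZero n}} → sumTo f n ≡ f n + sumTo f (pred n)
sumTo-pred f (suc n) = refl

sumTo-vanishing : ∀ {f} n → (∀ k → 0 < k → k ≤ n → f k ≡ 0) → sumTo f n ≡ 0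
sumTo-vanishing zero    _   = refl
sumTo-vanishing (suc n) f≡0 = cong₂ _+_ (f≡0 (suc n) z<s ≤-refl)
  (sumTo-vanishing n (λ k 0<k k≤n → f≡0 k 0<k (m≤n⇒m≤1+n k≤n)))

sumTo-+ : ∀ f g n → sumTo (λ k → f k + g k) n ≡ sumTo f n + sumTo g n
sumTo-+ f g zero    = refl
sumTo-+ f g (suc n) = trans (cong (f (suc n) + g (suc n) +_) (sumTo-+ f g n))
  (solve 4 (λ a b c d → (a :+ b) :+ (c :+ d) := (a :+ c) :+ (b :+ d)) refl
    (f (suc n)) (g (suc n)) (sumTo f n) (sumTo g n))

sumTo-split : ∀ f m n → sumTo f (m + n) ≡ sumTo f m + sumTo (f ∘ (m +_)) n
sumTo-split f m zero    = trans (cong (sumTo f) (+-identityʳ m)) (sym (+-identityʳ _))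
sumTo-split f m (suc n) = begin
  sumTo f (m + suc n)                                  ≡⟨ cong (sumTo f) (+-suc m n) ⟩
  f (suc (m + n)) + sumTo f (m + n)                    ≡⟨ cong (f (suc (m + n)) +_) (sumTo-split f m n) ⟩
  f (suc (m + n)) + (sumTo f m + sumTo (f ∘ (m +_)) n) ≡⟨ +-comm-middle (f (suc (m + n))) (sumTo f m) _ ⟩
  sumTo f m + (f (suc (m + n)) + sumTo (f ∘ (m +_)) n) ≡⟨ cong (λ x → sumTo f m + (f x + sumTo (f ∘ (m +_)) n)) (+-suc m n) ⟨
  sumTo f m + sumTo (f ∘ (m +_)) (suc n)               ∎
  where
  +-comm-middle : ∀ a b c → a + (b + c) ≡ b + (a + c)
  +-comm-middle = solve 3 (λ a b c → a :+ (b :+ c) := b :+ (a :+ c)) refl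

sumTo-periodic : ∀ f t → (∀ k → f (t + k) ≡ f k) → ∀ a → sumTo f (a * t) ≡ a * sumTo f t
sumTo-periodic f t periodic zero    = refl
sumTo-periodic f t periodic (suc a) = trans (sumTo-split f t (a * t))
  (cong (sumTo f t +_) (trans (sumTo-cong periodic (a * t)) (sumTo-periodic f t periodic a)))

onMultiplesOf : ℕ → (ℕ → ℕ) → ℕ → ℕ
onMultiplesOf d f k = if does (d ∣? k) then f k else 0

onMultiplesOf-∣ : ∀ {d k} f → d ∣ k → onMultiplesOf d f k ≡ f k
onMultiplesOf-∣ {d} {k} f d∣k rewrite dec-true (d ∣? k) d∣k = refl

onMultiplesOf-∤ : ∀ {d k} f → ¬ d ∣ k → onMultiplesOf d f k ≡ 0
onMultiplesOf-∤ {d} {k} f d∤k rewrite dec-false (d ∣? k) d∤k = refl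

sumTo-onMultiplesOf : ∀ d .{{_ : NonZero d}} f b →
  sumTo (onMultiplesOf d f) (d * b) ≡ sumTo (f ∘ (d *_)) b
sumTo-onMultiplesOf d f zero    rewrite *-zeroʳ d = refl
sumTo-onMultiplesOf d f (suc b) = begin
  sumTo g (d * suc b)                          ≡⟨ cong (sumTo g) d*[1+b]≡ ⟩
  sumTo g (d * b + d)                          ≡⟨ sumTo-split g (d * b) d ⟩
  sumTo g (d * b) + sumTo (g ∘ (d * b +_)) d   ≡⟨ cong₂ _+_ (sumTo-onMultiplesOf d f b) lastBlock ⟩
  sumTo (f ∘ (d *_)) b + f (d * suc b)         ≡⟨ +-comm (sumTo (f ∘ (d *_)) b) _ ⟩
  sumTo (f ∘ (d *_)) (suc b)                   ∎
  where
  g : ℕ → ℕ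
  g = onMultiplesOf d f
  d*[1+b]≡ : d * suc b ≡ d * b + d
  d*[1+b]≡ = trans (*-suc d b) (+-comm d (d * b))
  gap : ∀ k → 0 < k → k ≤ pred d → g (d * b + k) ≡ 0
  gap k@(suc _) _ k≤d-1 = onMultiplesOf-∤ f λ d∣db+k →
    >⇒∤ (m≤pred[n]⇒suc[m]≤n k≤d-1) (∣m+n∣m⇒∣n d∣db+k (m∣m*n b))
  lastBlock : sumTo (g ∘ (d * b +_)) d ≡ f (d * suc b)
  lastBlock = begin
    sumTo (g ∘ (d * b +_)) d                          ≡⟨ sumTo-pred (g ∘ (d * b +_)) d ⟩
    g (d * b + d) + sumTo (g ∘ (d * b +_)) (pred d)   ≡⟨ cong₂ _+_ (onMultiplesOf-∣ {d} f (∣m∣n⇒∣m+n (m∣m*n b) ∣-refl))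
                                                                     (sumTo-vanishing (pred d) gap) ⟩
    f (d * b + d) + 0                                 ≡⟨ +-identityʳ _ ⟩
    f (d * b + d)                                     ≡⟨ cong f d*[1+b]≡ ⟨
    f (d * suc b)                                     ∎

coprime-* : ∀ {k m n} → Coprime k m → Coprime k n → Coprime k (m * n)
coprime-* c₁ c₂ (d∣k , d∣mn) =
  c₂ (d∣k , coprime-divisor (λ (e∣d , e∣m) → c₁ (∣-trans e∣d d∣k , e∣m)) d∣mn)

coprime-*⇒coprimeˡ : ∀ {k m n} → Coprime k (m * n) → Coprime k m
coprime-*⇒coprimeˡ {n = n} c (d∣k , d∣m) = c (d∣k , ∣m⇒∣m*n n d∣m)

coprime-*⇒coprimeʳ : ∀ {k m n} → Coprime k (m * n) → Coprime k n
coprime-*⇒coprimeʳ {m = m} c (d∣k , d∣n) = c (d∣k , ∣n⇒∣m*n m d∣n)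

coprime-+⁻¹ : ∀ {m n} → Coprime (n + m) n → Coprime m n
coprime-+⁻¹ c (d∣m , d∣n) = c (∣m∣n⇒∣m+n d∣n d∣m , d∣n)

coprimeIndicator : ℕ → ℕ → ℕ
coprimeIndicator k n = if does (gcd k n ≟ 1) then 1 else 0

φ≡sumTo-coprimeIndicator : ∀ n → φ n ≡ sumTo (λ k → coprimeIndicator k n) n
φ≡sumTo-coprimeIndicator n = coprimeCount≡sumTo n
  where
  coprimeCount≡sumTo : ∀ b → coprimeCount n b ≡ sumTo (λ k → coprimeIndicator k n) b
  coprimeCount≡sumTo zero    = refl
  coprimeCount≡sumTo (suc b) = cong (coprimeIndicator (suc b) n +_) (coprimeCount≡sumTo b)

coprimeIndicator-coprime : ∀ {a b} → Coprime a b → coprimeIndicator a b ≡ 1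
coprimeIndicator-coprime {a} {b} c rewrite dec-true (gcd a b ≟ 1) (coprime⇒gcd≡1 c) = refl

coprimeIndicator-¬coprime : ∀ {a b} → ¬ Coprime a b → coprimeIndicator a b ≡ 0
coprimeIndicator-¬coprime {a} {b} ¬c rewrite dec-false (gcd a b ≟ 1) (¬c ∘ gcd≡1⇒coprime) = refl

coprimeIndicator-cong : ∀ a b c d → (Coprime a b → Coprime c d) → (Coprime c d → Coprime a b) →
  coprimeIndicator a b ≡ coprimeIndicator c d
coprimeIndicator-cong a b c d to from with coprime? a b
... | yes ab = trans (coprimeIndicator-coprime ab) (sym (coprimeIndicator-coprime (to ab)))
... | no ¬ab = trans (coprimeIndicator-¬coprime ¬ab) (sym (coprimeIndicator-¬coprime (¬ab ∘ from)))

module _ {p : ℕ} (p-prime : Prime p) where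

  private
    instance
      p≢0 : NonZero p
      p≢0 = prime⇒nonZero p-prime

    p≢1 : p ≢ 1
    p≢1 = nonTrivial⇒≢1 {{prime⇒nonTrivial p-prime}}

    p>1 : 1 < p
    p>1 = nonTrivial⇒n>1 p {{prime⇒nonTrivial p-prime}}

  prime∤⇒coprime : ∀ {k} → ¬ p ∣ k → Coprime k p
  prime∤⇒coprime p∤k (d∣k , d∣p) with prime⇒irreducible p-prime d∣p
  ... | inj₁ d≡1 = d≡1
  ... | inj₂ refl = contradiction d∣k p∤k

  prime∣⇒¬coprime : ∀ {m n} → p ∣ m → p ∣ n → ¬ Coprime m n
  prime∣⇒¬coprime p∣m p∣n c = p≢1 (c (p∣m , p∣n))

  coprimeIndicator-*-prime : ∀ t k →
    coprimeIndicator k t ≡ coprimeIndicator k (t * p) + onMultiplesOf p (λ k → coprimeIndicator k t) k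
  coprimeIndicator-*-prime t k = byCases (p ∣? k)
    where
    byCases : Dec (p ∣ k) →
      coprimeIndicator k t ≡ coprimeIndicator k (t * p) + onMultiplesOf p (λ k → coprimeIndicator k t) k
    byCases (yes p∣k) = sym (cong₂ _+_ (coprimeIndicator-¬coprime (prime∣⇒¬coprime p∣k (n∣m*n t)))
                                       (onMultiplesOf-∣ (λ k → coprimeIndicator k t) p∣k))
    byCases (no p∤k)  = sym (trans (cong₂ _+_ χ[k,t*p]≡χ[k,t] (onMultiplesOf-∤ (λ k → coprimeIndicator k t) p∤k))
                                   (+-identityʳ _))
      where
      χ[k,t*p]≡χ[k,t] : coprimeIndicator k (t * p) ≡ coprimeIndicator k t
      χ[k,t*p]≡χ[k,t] = coprimeIndicator-cong k (t * p) k t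
        coprime-*⇒coprimeˡ (λ c → coprime-* c (prime∤⇒coprime p∤k))

  coprimeMultiplesCount : ℕ → ℕ
  coprimeMultiplesCount t = sumTo (λ j → coprimeIndicator (p * j) t) t

  p*φ≡φ[*p]+coprimeMultiplesCount : ∀ t → p * φ t ≡ φ (t * p) + coprimeMultiplesCount t
  p*φ≡φ[*p]+coprimeMultiplesCount t = begin
    p * φ t                                               ≡⟨ cong (p *_) (φ≡sumTo-coprimeIndicator t) ⟩
    p * sumTo χ t                                         ≡⟨ sumTo-periodic χ t χ-periodic p ⟨
    sumTo χ (p * t)                                       ≡⟨ sumTo-cong (coprimeIndicator-*-prime t) (p * t) ⟩
    sumTo (λ k → χₚ k + onMultiplesOf p χ k) (p * t)      ≡⟨ sumTo-+ χₚ (onMultiplesOf p χ) (p * t) ⟩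
    sumTo χₚ (p * t) + sumTo (onMultiplesOf p χ) (p * t)  ≡⟨ cong₂ _+_ sumTo-χₚ (sumTo-onMultiplesOf p χ t) ⟩
    φ (t * p) + coprimeMultiplesCount t                   ∎
    where
    χ χₚ : ℕ → ℕ
    χ k = coprimeIndicator k t
    χₚ k = coprimeIndicator k (t * p)
    χ-periodic : ∀ k → χ (t + k) ≡ χ k
    χ-periodic k = coprimeIndicator-cong (t + k) t k t coprime-+⁻¹ coprime-+
    sumTo-χₚ : sumTo χₚ (p * t) ≡ φ (t * p)
    sumTo-χₚ = trans (cong (sumTo χₚ) (*-comm p t)) (sym (φ≡sumTo-coprimeIndicator (t * p)))

  coprimeMultiplesCount-∤ : ∀ {t} → ¬ p ∣ t → coprimeMultiplesCount t ≡ φ t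
  coprimeMultiplesCount-∤ {t} p∤t =
    trans (sumTo-cong χ[p*j]≡χ[j] t) (sym (φ≡sumTo-coprimeIndicator t))
    where
    χ[p*j]≡χ[j] : ∀ j → coprimeIndicator (p * j) t ≡ coprimeIndicator j t
    χ[p*j]≡χ[j] j = coprimeIndicator-cong (p * j) t j t
      (coprime-sym ∘ coprime-*⇒coprimeʳ {m = p} ∘ coprime-sym)
      (λ c → coprime-sym (coprime-* (prime∤⇒coprime p∤t) (coprime-sym c)))

  coprimeMultiplesCount-∣ : ∀ {t} → p ∣ t → coprimeMultiplesCount t ≡ 0
  coprimeMultiplesCount-∣ {t} p∣t = sumTo-vanishing t λ j _ _ →
    coprimeIndicator-¬coprime (prime∣⇒¬coprime (m∣m*n j) p∣t)

  φ-*-prime-∤ : ∀ {t} → ¬ p ∣ t → φ (t * p) ≡ pred p * φ t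
  φ-*-prime-∤ {t} p∤t = +-cancelʳ-≡ (φ t) _ _ (begin
    φ (t * p) + φ t                      ≡⟨ cong (φ (t * p) +_) (coprimeMultiplesCount-∤ p∤t) ⟨
    φ (t * p) + coprimeMultiplesCount t  ≡⟨ p*φ≡φ[*p]+coprimeMultiplesCount t ⟨
    p * φ t                              ≡⟨ cong (_* φ t) (suc-pred p) ⟨
    φ t + pred p * φ t                   ≡⟨ +-comm (φ t) _ ⟩
    pred p * φ t + φ t                   ∎)

  φ-*-prime-∣ : ∀ {t} → p ∣ t → φ (t * p) ≡ p * φ t
  φ-*-prime-∣ {t} p∣t = begin
    φ (t * p)                            ≡⟨ +-identityʳ _ ⟨
    φ (t * p) + 0                        ≡⟨ cong (φ (t * p) +_) (coprimeMultiplesCount-∣ p∣t) ⟨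
    φ (t * p) + coprimeMultiplesCount t  ≡⟨ p*φ≡φ[*p]+coprimeMultiplesCount t ⟨
    p * φ t                              ∎

  prime∣⇒pred∣φ : ∀ n → p ∣ n → pred p ∣ φ n
  prime∣⇒pred∣φ = <-rec (λ n → p ∣ n → pred p ∣ φ n) step
    where
    step : ∀ n → (∀ {m} → m < n → p ∣ m → pred p ∣ φ m) → p ∣ n → pred p ∣ φ n
    step _ _   (divides zero refl) = pred p ∣0
    step _ rec (divides t@(suc _) refl) with p ∣? t
    ... | no  p∤t = subst (pred p ∣_) (sym (φ-*-prime-∤ p∤t)) (m∣m*n (φ t))
    ... | yes p∣t = subst (pred p ∣_) (sym (φ-*-prime-∣ p∣t))
      (∣n⇒∣m*n p (rec (m<m*n t p p>1) p∣t))

theorem4p1 : (q : ℕ) → Prime q → Prime (2 * q + 1) →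
    (zp Pq : ℕ) → IsZ (2 * q + 1) zp → IsPisano q Pq →
    zp ∣ Pq →
    ∃ λ r → InS q Pq r
theorem4p1 q _ p-prime zp Pq (_ , p∣F[zp] , _) (0<Pq , _ , _) zp∣Pq =
  0 , 0<Pq , λ m _ (k , m≡kPq) → q∣φ (∣-trans p∣F[zp] (∣⇒F∣F (∣-trans zp∣Pq (divides k m≡kPq))))
  where
  q∣pred[2q+1] : q ∣ pred (2 * q + 1)
  q∣pred[2q+1] = subst (q ∣_) (cong pred (+-comm 1 (2 * q))) (n∣m*n 2)
  q∣φ : ∀ {n} → 2 * q + 1 ∣ n → q ∣ φ n
  q∣φ p∣n = ∣-trans q∣pred[2q+1] (prime∣⇒pred∣φ p-prime _ p∣n)
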